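{- Let $T$ be a tournament on $\{1,\ldots,n\}$. Suppose $T$ contains a closed alternating walk $(c_0,c_1,\ldots,c_{2k-1})$, that is, a closed directed walk $c_0\to c_1\to\cdots\to c_{2k-1}\to c_0$ in which descents and ascents alternate. Then $T$ contains an alternating cycle of length $4$.
   Context: A tournament on $\{1,\ldots,n\}$ is a directed graph on the vertex set $\{1,\ldots,n\}$ with no loops or multiple edges such that for each pair $i\neq j$ exactly one of the arcs $i\to j$, $j\to i$ is present. An arc $i\to j$ is an ascent if $i<j$ and a descent if $i>j$. A directed cycle $(c_0,\ldots,c_{2k-1})$ (indices mod $2k$) is alternating if ascents and descents alternate along it, i.e. $c_{2j}\to c_{2j+1}$ are descents and $c_{2j+1}\to c_{2j+2}$ are ascents for all $j$. In a walk, vertices may be revisited. -}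

module Defs where

open import Data.Nat using (ℕ; zero; suc; _+_; _*_; _%_; NonZero)
open import Data.Nat.DivMod using (m%n<n)
open import Data.Fin using (Fin; toℕ; fromℕ<; _<_; _>_)
open import Data.Product using (_×_; ∃-syntax)
open import Data.Sum using (_⊎_)
open import Relation.Nullary using (¬_)
open import Relation.Binary.PropositionalEquality using (_≡_; _≢_)

-- Vertices {1,…,n} are represented by Fin n (i ↦ i+1, order-preserving).
-- A tournament: an arc relation, loopless, with exactly one arc between
-- each pair of distinct vertices.
record Tournament (n : ℕ) : Set₁ where
  field
    Arc        : Fin n → Fin n → Set
    loopless   : ∀ i → ¬ Arc i i
    total      : ∀ i j → i ≢ j → Arc i j ⊎ Arc j i
    asymmetric : ∀ i j → Arc i j → ¬ Arc j i

open Tournament public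

_mod_ : (i m : ℕ) → .{{NonZero m}} → Fin m
i mod m = fromℕ< (m%n<n i m)

record ClosedAltWalk {n : ℕ} (T : Tournament n) (k : ℕ) : Set where
  field
    c    : Fin (2 * suc k) → Fin n
    desc : ∀ (j : ℕ) →
             Arc T (c ((2 * j) mod (2 * suc k)))
                   (c ((2 * j + 1) mod (2 * suc k)))
           × c ((2 * j) mod (2 * suc k)) > c ((2 * j + 1) mod (2 * suc k))
    asc  : ∀ (j : ℕ) →
             Arc T (c ((2 * j + 1) mod (2 * suc k)))
                   (c ((2 * j + 2) mod (2 * suc k)))
           × c ((2 * j + 1) mod (2 * suc k)) < c ((2 * j + 2) mod (2 * suc k))

AltCycle4 : {n : ℕ} → Tournament n → Set
AltCycle4 {n} T = ∃[ a ] ∃[ b ] ∃[ c ] ∃[ d ]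
  ( a ≢ b × a ≢ c × a ≢ d × b ≢ c × b ≢ d × c ≢ d
  × Arc T a b × a > b
  × Arc T b c × b < c
  × Arc T c d × c > d
  × Arc T d a × d < a )

-- Every bottom c₂ⱼ₊₁ of the walk lies below the following top c₂ⱼ₊₂, hence
-- below a highest top t. The bottom right after t receives the arc t → b,
-- while the bottom right before t (one period later) sends an arc into t; so
-- some consecutive bottoms b, b' have t → b and b' → t. With t' the top
-- between them, t → b → t' → b' → t is an alternating 4-cycle.
module Submission where

open import Data.Nat as ℕ using (ℕ; zero; suc; _+_; _*_; _%_; _/_; NonZero; z≤n; s≤s)
open import Data.Nat.Properties as ℕ using (+-identityʳ; +-comm; +-assoc; +-suc; *-distribˡ-+; m≤m+n; <-≤-trans)
open import Data.Nat.DivMod using (m%n<n; m≡m%n+[m/n]*n; [m+n]%n≡m%n)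
open import Data.Fin using (Fin; toℕ; _<_; _>_)
open import Data.Fin.Properties using (toℕ-injective; toℕ-fromℕ<; <⇒≢; ≤-totalOrder)
import Data.Fin as Fin
open import Data.List using (upTo)
open import Data.List.Relation.Unary.All using (lookup)
open import Data.List.Membership.Propositional.Properties using (∈-upTo⁺)
open import Data.Product using (_×_; _,_; ∃-syntax; proj₁; proj₂)
open import Data.Sum using (inj₁; inj₂)
open import Data.Empty using (⊥-elim)
open import Relation.Binary.Bundles using (TotalOrder)
open import Relation.Nullary using (¬_; Dec; yes; no)
open import Relation.Unary using (Pred; Decidable)
open import Relation.Binary.PropositionalEquality
open import Defs

module _ {p} {P : Pred ℕ p} (P? : Decidable P) where

  ∃-flip : ∀ {m n} → m ℕ.≤ n → P m → ¬ P n → ∃[ i ] (P i × ¬ P (suc i))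
  ∃-flip {n = zero} z≤n pm ¬pn = ⊥-elim (¬pn pm)
  ∃-flip {n = suc n} m≤1+n pm ¬p1+n with ℕ.m≤n⇒m<n∨m≡n m≤1+n
  ... | inj₂ refl = ⊥-elim (¬p1+n pm)
  ... | inj₁ (s≤s m≤n) with P? n
  ...   | yes pn = n , pn , ¬p1+n
  ...   | no ¬pn = ∃-flip m≤n pm ¬pn

module _ {a} {A : Set a} (f : ℕ → A) (p : ℕ) .{{_ : NonZero p}}
         (periodic : ∀ j → f (j + p) ≡ f j) where

  periodic-+* : ∀ r q → f (r + q * p) ≡ f r
  periodic-+* r zero = cong f (+-identityʳ r)
  periodic-+* r (suc q) = begin
    f (r + (p + q * p))  ≡⟨ cong (λ x → f (r + x)) (+-comm p (q * p)) ⟩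
    f (r + (q * p + p))  ≡⟨ cong f (sym (+-assoc r (q * p) p)) ⟩
    f (r + q * p + p)    ≡⟨ periodic (r + q * p) ⟩
    f (r + q * p)        ≡⟨ periodic-+* r q ⟩
    f r                  ∎
    where open ≡-Reasoning

  periodic-% : ∀ j → f j ≡ f (j % p)
  periodic-% j = trans (cong f (m≡m%n+[m/n]*n j p)) (periodic-+* (j % p) (j / p))

module _ {b ℓ₁ ℓ₂} (O : TotalOrder b ℓ₁ ℓ₂) where
  open TotalOrder O renaming (Carrier to B)
  open import Data.List.Extrema O using (argmax; f[xs]≤f[argmax])

  periodic-max : (f : ℕ → B) (p : ℕ) .{{_ : NonZero p}} → (∀ j → f (j + p) ≡ f j) →
                 ∃[ M ] (∀ j → f j ≤ f M)
  periodic-max f p periodic = M , f≤fM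
    where
    M : ℕ
    M = argmax f 0 (upTo p)
    f≤fM : ∀ j → f j ≤ f M
    f≤fM j = subst (_≤ f M) (sym (periodic-% f p periodic j))
                   (lookup (f[xs]≤f[argmax] {f = f} 0 (upTo p)) (∈-upTo⁺ (m%n<n j p)))

mod-+-self : ∀ x m .{{_ : NonZero m}} → (x + m) mod m ≡ x mod m
mod-+-self x m = toℕ-injective (begin
  toℕ ((x + m) mod m)  ≡⟨ toℕ-fromℕ< (m%n<n (x + m) m) ⟩
  (x + m) % m          ≡⟨ [m+n]%n≡m%n x m ⟩
  x % m                ≡⟨ toℕ-fromℕ< (m%n<n x m) ⟨
  toℕ (x mod m)        ∎)
  where open ≡-Reasoning

module _ {n} (T : Tournament n) where

  Arc? : ∀ {u v} → u ≢ v → Dec (Arc T u v)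
  Arc? {u} {v} u≢v with total T u v u≢v
  ... | inj₁ uv = yes uv
  ... | inj₂ vu = no (asymmetric T v u vu)

  ¬Arc⇒Arc : ∀ {u v} → u ≢ v → ¬ Arc T u v → Arc T v u
  ¬Arc⇒Arc {u} {v} u≢v ¬uv with total T u v u≢v
  ... | inj₁ uv = ⊥-elim (¬uv uv)
  ... | inj₂ vu = vu

  alternating-4-cycle : ∀ {a b c d} →
    Arc T a b → a > b → Arc T b c → b < c →
    Arc T c d → c > d → Arc T d a → d < a → AltCycle4 T
  alternating-4-cycle {a} {b} {c} {d} ab a>b bc b<c cd c>d da d<a =
    a , b , c , d ,
    (λ a≡b → <⇒≢ a>b (sym a≡b)) ,
    (λ { refl → asymmetric T a b ab bc }) ,
    (λ a≡d → <⇒≢ d<a (sym a≡d)) ,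
    <⇒≢ b<c ,
    (λ { refl → asymmetric T b c bc cd }) ,
    (λ c≡d → <⇒≢ c>d (sym c≡d)) ,
    ab , a>b , bc , b<c , cd , c>d , da , d<a

module _ {n} {T : Tournament n} {k} (W : ClosedAltWalk T k) where
  open ClosedAltWalk W

  top bottom : ℕ → Fin n
  top j = c ((2 * j) mod (2 * suc k))
  bottom j = c ((2 * j + 1) mod (2 * suc k))

  top-periodic : ∀ j → top (j + suc k) ≡ top j
  top-periodic j = cong c (begin
    (2 * (j + suc k)) mod (2 * suc k)  ≡⟨ cong (_mod (2 * suc k)) (*-distribˡ-+ 2 j (suc k)) ⟩
    (2 * j + 2 * suc k) mod (2 * suc k) ≡⟨ mod-+-self (2 * j) (2 * suc k) ⟩
    (2 * j) mod (2 * suc k)            ∎)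
    where open ≡-Reasoning

  descent : ∀ j → Arc T (top j) (bottom j) × top j > bottom j
  descent = desc

  ascent : ∀ j → Arc T (bottom j) (top (suc j)) × bottom j < top (suc j)
  ascent j = subst (λ x → Arc T (bottom j) x × bottom j < x) next (asc j)
    where
    next : c ((2 * j + 2) mod (2 * suc k)) ≡ top (suc j)
    next = cong (λ x → c (x mod (2 * suc k)))
                (trans (+-comm (2 * j) 2) (sym (*-distribˡ-+ 2 1 j)))

  module _ (M : ℕ) (top≤top[M] : ∀ j → top j Fin.≤ top M) where

    bottom<top[M] : ∀ j → bottom j < top M
    bottom<top[M] j = <-≤-trans (proj₂ (ascent j)) (top≤top[M] (suc j))

    top[M]≢bottom : ∀ j → top M ≢ bottom j
    top[M]≢bottom j eq = <⇒≢ (bottom<top[M] j) (sym eq)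

    bottom[M+k]→top[M] : Arc T (bottom (M + k)) (top M)
    bottom[M+k]→top[M] = subst (Arc T (bottom (M + k)))
                               (trans (cong top (sym (+-suc M k))) (top-periodic M))
                               (proj₁ (ascent (M + k)))

    maximal-top⇒AltCycle4 : AltCycle4 T
    maximal-top⇒AltCycle4
      with ∃-flip (λ j → Arc? T (top[M]≢bottom j)) (m≤m+n M k) (proj₁ (descent M))
                  (asymmetric T _ _ bottom[M+k]→top[M])
    ... | j , top[M]→bⱼ , ¬top[M]→bⱼ₊₁ =
      alternating-4-cycle T
        top[M]→bⱼ (bottom<top[M] j)
        (proj₁ (ascent j)) (proj₂ (ascent j))
        (proj₁ (descent (suc j))) (proj₂ (descent (suc j)))
        (¬Arc⇒Arc T (top[M]≢bottom (suc j)) ¬top[M]→bⱼ₊₁) (bottom<top[M] (suc j))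

theorem2p2 : (n : ℕ) (T : Tournament n) (k : ℕ) → ClosedAltWalk T k → AltCycle4 T
theorem2p2 n T k W =
  let M , top≤top[M] = periodic-max (≤-totalOrder n) (top W) (suc k) (top-periodic W)
  in maximal-top⇒AltCycle4 W M top≤top[M]
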